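{- A Boolean combination $\varphi$ of core formulae is valid if and only if $\vdash_{\mathsf{C}}\varphi$.
   Context: Syntax of $\mathrm{SL}(\ast,\mathrel{ -\!\!\ast})$: fix a countably infinite set $\mathrm{PVAR}$ of program variables and a countably infinite set $\mathrm{LOC}$ of locations. Formulae: $\varphi ::= x = y \mid x \hookrightarrow y \mid \mathrm{emp} \mid \neg\varphi \mid \varphi\wedge\varphi \mid \varphi \ast \varphi \mid \varphi \mathrel{ -\!\!\ast} \varphi$ ($x,y\in\mathrm{PVAR}$). Memory states $(s,h)$: $s:\mathrm{PVAR}\to\mathrm{LOC}$, $h$ a partial function $\mathrm{LOC}\to\mathrm{LOC}$ with finite domain. $(s,h)\models x=y$ iff $s(x)=s(y)$; $\models\mathrm{emp}$ iff $\mathrm{dom}(h)=\emptyset$; $\models x\hookrightarrow y$ iff $s(x)\in\mathrm{dom}(h)$ and $h(s(x))=s(y)$; Boolean connectives as usual; $\models\varphi_1\ast\varphi_2$ iff $h$ splits into two domain-disjoint heaps $h_1,h_2$ ($h=h_1+h_2$) with $(s,h_i)\models\varphi_i$; $\models\varphi_1\mathrel{ -\!\!\ast}\varphi_2$ iff for every $h_1$ with domain disjoint from $\mathrm{dom}(h)$ and $(s,h_1)\models\varphi_1$, $(s,h+h_1)\models\varphi_2$. Valid = satisfied by all memory states. Abbreviations: $\bot:=\neg(x=x)$, $\top:=\neg\bot$, $\mathrm{alloc}(x):=(x\hookrightarrow x)\mathrel{ -\!\!\ast}\bot$ (holds iff $s(x)\in\mathrm{dom}(h)$), $\mathrm{size}\ge0:=\top$,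 $\mathrm{size}\ge1:=\neg\mathrm{emp}$, $\mathrm{size}\ge\beta:=\neg\mathrm{emp}\ast\mathrm{size}\ge\beta-1$ for $\beta\ge2$ (holds iff $|\mathrm{dom}(h)|\ge\beta$). Core formulae are the formulae $x=y$, $\mathrm{alloc}(x)$, $x\hookrightarrow y$, $\mathrm{size}\ge\beta$ with $x,y\in\mathrm{PVAR}$, $\beta\in\mathbb{N}$. The proof system $\mathsf{C}$ (derivability is the least set of formulae containing all instances of the axiom schemata and closed under the rules) consists of all axiom schemata of classical propositional calculus, modus ponens, and: (1) $x=x$; (2) $\varphi\wedge x=y\Rightarrow\varphi'$, where $\varphi'$ is obtained from $\varphi$ by replacing every occurrence of $y$ with $x$; (3) $x\hookrightarrow y\Rightarrow\mathrm{alloc}(x)$; (4) $(x\hookrightarrow y\wedge x\hookrightarrow z)\Rightarrow y=z$; (5) $\mathrm{size}\ge\beta+1\Rightarrow\mathrm{size}\ge\beta$ for $\beta\in\mathbb{N}$; (6) $\bigwedge_{x\in X}(\mathrm{alloc}(x)\wedge\bigwedge_{y\in X\setminus\{x\}}\neg(x=y))\Rightarrow\mathrm{size}\ge|X|$ for finite $X\subseteq\mathrm{PVAR}$. -}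

module Defs where

open import Data.Nat using (ℕ; zero; suc; _≤_; _≟_)
open import Data.Bool using (Bool; true; false; not; _∧_)
open import Data.Maybe using (Maybe; just; nothing)
open import Data.Product using (_×_; _,_; ∃)
open import Data.Sum using (_⊎_)
open import Data.Empty using (⊥)
open import Data.List using (List; []; _∷_; length; filter)
open import Data.List.Relation.Unary.Unique.Propositional using (Unique)
open import Relation.Nullary using (¬_; ¬?)
open import Relation.Binary.PropositionalEquality using (_≡_)

PVAR : Set
PVAR = ℕ

LOC : Set
LOC = ℕ

infix  8 _≐_ _↪_
infixr 6 _∧'_
infixr 5 _⇒'_
infixr 6 _*'_
infixr 5 _-*_

data Form : Set where
  _≐_  : PVAR → PVAR → Form
  _↪_  : PVAR → PVAR → Form
  emp  : Form
  ¬'_  : Form → Form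
  _∧'_ : Form → Form → Form
  _*'_ : Form → Form → Form
  _-*_ : Form → Form → Form

_⇒'_ : Form → Form → Form
φ ⇒' ψ = ¬' (φ ∧' ¬' ψ)

Store : Set
Store = PVAR → LOC

record Heap : Set where
  field
    at     : LOC → Maybe LOC
    finite : ∃ λ (b : ℕ) → ∀ l → b ≤ l → at l ≡ nothing
open Heap public

Split : Heap → Heap → Heap → Set
Split h h₁ h₂ = ∀ l → (at h l ≡ at h₁ l × at h₂ l ≡ nothing)
                    ⊎ (at h l ≡ at h₂ l × at h₁ l ≡ nothing)

_,_⊨_ : Store → Heap → Form → Set
s , h ⊨ (x ≐ y)   = s x ≡ s y
s , h ⊨ (x ↪ y)   = at h (s x) ≡ just (s y)
s , h ⊨ emp       = ∀ l → at h l ≡ nothing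
s , h ⊨ (¬' φ)    = ¬ (s , h ⊨ φ)
s , h ⊨ (φ ∧' ψ)  = (s , h ⊨ φ) × (s , h ⊨ ψ)
s , h ⊨ (φ *' ψ)  = ∃ λ h₁ → ∃ λ h₂ → Split h h₁ h₂ × (s , h₁ ⊨ φ) × (s , h₂ ⊨ ψ)
s , h ⊨ (φ -* ψ)  = ∀ h₁ h' → Split h' h h₁ → s , h₁ ⊨ φ → s , h' ⊨ ψ

Valid : Form → Set
Valid φ = ∀ s h → s , h ⊨ φ

⊥' : Form
⊥' = ¬' (0 ≐ 0)

⊤' : Form
⊤' = ¬' ⊥'

alloc : PVAR → Form
alloc x = (x ↪ x) -* ⊥'

size≥ : ℕ → Form
size≥ zero          = ⊤'
size≥ (suc zero)    = ¬' emp
size≥ (suc (suc β)) = ¬' emp *' size≥ (suc β)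

data Core : Form → Set where
  core-eq    : ∀ x y → Core (x ≐ y)
  core-alloc : ∀ x → Core (alloc x)
  core-pt    : ∀ x y → Core (x ↪ y)
  core-size  : ∀ β → Core (size≥ β)

data BoolComb : Form → Set where
  bc-core : ∀ {φ} → Core φ → BoolComb φ
  bc-not  : ∀ {φ} → BoolComb φ → BoolComb (¬' φ)
  bc-and  : ∀ {φ ψ} → BoolComb φ → BoolComb ψ → BoolComb (φ ∧' ψ)

data PForm : Set where
  patom : ℕ → PForm
  pnot  : PForm → PForm
  pand  : PForm → PForm → PForm

peval : (ℕ → Bool) → PForm → Bool
peval v (patom n)  = v n
peval v (pnot p)   = not (peval v p)
peval v (pand p q) = peval v p ∧ peval v q

Tautology : PForm → Set
Tautology p = ∀ v → peval v p ≡ true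

instantiate : (ℕ → Form) → PForm → Form
instantiate σ (patom n)  = σ n
instantiate σ (pnot p)   = ¬' instantiate σ p
instantiate σ (pand p q) = instantiate σ p ∧' instantiate σ q

rnVar : PVAR → PVAR → PVAR → PVAR
rnVar y x z with z ≟ y
... | Relation.Nullary.yes _ = x
... | Relation.Nullary.no  _ = z

replace : PVAR → PVAR → Form → Form
replace y x (a ≐ b)  = rnVar y x a ≐ rnVar y x b
replace y x (a ↪ b)  = rnVar y x a ↪ rnVar y x b
replace y x emp      = emp
replace y x (¬' φ)   = ¬' replace y x φ
replace y x (φ ∧' ψ) = replace y x φ ∧' replace y x ψ
replace y x (φ *' ψ) = replace y x φ *' replace y x ψ
replace y x (φ -* ψ) = replace y x φ -* replace y x ψ

⋀ : List Form → Form
⋀ []       = ⊤'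
⋀ (φ ∷ φs) = φ ∧' ⋀ φs

mapF : (PVAR → Form) → List PVAR → List Form
mapF f []       = []
mapF f (x ∷ xs) = f x ∷ mapF f xs

minus : List PVAR → PVAR → List PVAR
minus X x = filter (λ y → ¬? (y ≟ x)) X

-- antecedent of axiom (6) for the finite set X (given as a duplicate-free list)
allocDistinct : List PVAR → Form
allocDistinct X = ⋀ (mapF (λ x → alloc x ∧' ⋀ (mapF (λ y → ¬' (x ≐ y)) (minus X x))) X)

data ⊢_ : Form → Set where
  ax-taut  : ∀ (σ : ℕ → Form) (p : PForm) → Tautology p → ⊢ instantiate σ p
  mp       : ∀ {φ ψ} → ⊢ φ → ⊢ (φ ⇒' ψ) → ⊢ ψ
  ax-refl  : ∀ x → ⊢ (x ≐ x)
  ax-subst : ∀ φ x y → ⊢ ((φ ∧' (x ≐ y)) ⇒' replace y x φ)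
  ax-alloc : ∀ x y → ⊢ ((x ↪ y) ⇒' alloc x)
  ax-fun   : ∀ x y z → ⊢ (((x ↪ y) ∧' (x ↪ z)) ⇒' (y ≐ z))
  ax-size  : ∀ β → ⊢ (size≥ (suc β) ⇒' size≥ β)
  ax-fin   : ∀ (X : List PVAR) → Unique X → ⊢ (allocDistinct X ⇒' size≥ (length X))

module Submission where

-- Soundness is an induction on derivations.  Its semantic content is that alloc x and
-- size≥ β mean "s x is allocated" and "at least β cells are allocated" (alloc-sem, size-sem),
-- and that replacing y by x is harmless when s x = s y (replace-sem).
--
-- Completeness is a proof by cases on the truth values of finitely many atoms: the core
-- formulae of φ and the equalities x ≐ y between variables below a bound N of φ.  Each choice
-- of literals Γ has a canonical memory state: the store sends x to the least variable that Γ
-- proves equal to x; the heap allocates the locations of the variables Γ proves allocated,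
-- pointing where Γ's ↪-literals say, plus fresh cells up to the largest size bound Γ derives.
-- By the truth lemma Γ derives every Boolean combination of its atoms that is true in this
-- model, in particular the valid φ; combining all cases gives ⊢ φ.

open import Defs
open import Axiom.ExcludedMiddle using (ExcludedMiddle)
open import Level using (0ℓ)
open import Function.Bundles using (_⇔_; mk⇔; Equivalence)

open import Data.Nat using (ℕ; zero; suc; _≤_; _<_; _≟_; _<?_; _<ᵇ_; z≤n; s≤s; _+_; _⊔_; _∸_)
open import Data.Nat.Properties
  using (⊔-sel; ≡-decSetoid; +-cancelˡ-≡; +-monoʳ-<; <⇒≢; <-cmp; ≤-refl; ≤-trans; <-irrefl; ≤∧≢⇒<; ≤-pred; n≤1+n; m≤m+n; <-≤-trans; ≤-<-trans;
         <ᵇ⇒<; <⇒≱; m≤m⊔n; m≤n⊔m; m+[n∸m]≡n; suc-injective)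
open import Data.Bool using (Bool; true; false; not; _∧_; T)
open import Data.Bool.Properties using (T-∧; T-≡)
open import Data.Maybe using (Maybe; just; nothing)
open import Data.Maybe.Properties using (just-injective)
open import Data.Product using (_×_; _,_; ∃; Σ; proj₁; proj₂)
open import Data.Sum using (_⊎_; inj₁; inj₂)
open import Data.Empty using (⊥-elim)
open import Data.Unit using (⊤; tt)
open import Data.List using (List; []; _∷_; length; filter; map; _++_; upTo; applyUpTo; deduplicate; cartesianProductWith)
open import Data.List.Properties using (filter-notAll; length-map; length-++; length-applyUpTo)
open import Data.List.Relation.Unary.Any using (Any; here; there)
import Data.List.Relation.Unary.Any as Any
import Data.List.Relation.Unary.Any.Properties as Anyₚ
open import Data.List.Relation.Unary.All using (All; []; _∷_)
import Data.List.Relation.Unary.All as All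
import Data.List.Relation.Unary.All.Properties as Allₚ
open import Data.List.Relation.Unary.Unique.Propositional using (Unique)
open import Data.List.Relation.Unary.AllPairs using ([]; _∷_)
open import Data.List.Membership.Propositional using (_∈_; _∉_; find)
open import Data.List.Membership.Propositional.Properties
  using (∈-filter⁺; ∈-filter⁻; ∈-++⁺ˡ; ∈-++⁺ʳ; ∈-++⁻; ∈-map⁺; ∈-map⁻; ∈-upTo⁺; ∈-upTo⁻; ∈-applyUpTo⁻;
         ∈-deduplicate⁻; ∈-cartesianProductWith⁺)
open import Data.List.Membership.DecPropositional _≟_ using (_∈?_)
import Data.List.Relation.Unary.AllPairs.Properties as AllPairs
open import Data.List.Relation.Unary.Unique.DecSetoid.Properties using (deduplicate-!)
import Data.List.Relation.Unary.Unique.Propositional.Properties as Uniqueₚ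
open import Relation.Binary.Bundles using (DecSetoid)
import Relation.Binary.Construct.On as On
open import Relation.Nullary using (¬_; ¬?; Dec; yes; no; does; proof)
open import Relation.Nullary.Reflects using (Reflects; invert; ¬-reflects; _×-reflects_)
open import Relation.Binary.Definitions using (tri<; tri≈; tri>)
open import Relation.Binary.PropositionalEquality using (_≡_; _≢_; refl; sym; trans; cong; cong₂; subst; module ≡-Reasoning)

unique-⊆⇒length≤ : ∀ (L M : List ℕ) → Unique L → (∀ {l} → l ∈ L → l ∈ M) → length L ≤ length M
unique-⊆⇒length≤ [] M _ _ = z≤n
unique-⊆⇒length≤ (l ∷ L) M (l∉L ∷ uL) L⊆M =
  ≤-trans (s≤s (unique-⊆⇒length≤ L (filter (λ z → ¬? (z ≟ l)) M) uL L⊆M∖l))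
          (filter-notAll _ M (l-in-M (L⊆M (here refl))))
  where
  L⊆M∖l : ∀ {y} → y ∈ L → y ∈ filter (λ z → ¬? (z ≟ l)) M
  L⊆M∖l y∈L = ∈-filter⁺ (λ z → ¬? (z ≟ l)) (L⊆M (there y∈L)) (λ y≡l → All.lookup l∉L y∈L (sym y≡l))
  l-in-M : ∀ {M} → l ∈ M → Any (λ z → ¬ ¬ (z ≡ l)) M
  l-in-M = Any.map (λ l≡z z≢l → z≢l (sym l≡z))

map-unique : ∀ {A B : Set} (f : A → B) X → Unique X →
             (∀ {x y} → x ∈ X → y ∈ X → x ≢ y → f x ≢ f y) → Unique (map f X)
map-unique f []      _          _        = []
map-unique f (x ∷ X) (x∉X ∷ uX) separate =
  Allₚ.map⁺ (All.tabulate λ y∈X → separate (here refl) (there y∈X) (All.lookup x∉X y∈X)) ∷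
  map-unique f X uX (λ x∈X y∈X → separate (there x∈X) (there y∈X))

map-unique⁻ : ∀ {A B : Set} (f : A → B) X → Unique (map f X) → ∀ {x y} → x ∈ X → y ∈ X → f x ≡ f y → x ≡ y
map-unique⁻ f (z ∷ X) _          (here refl) (here refl) _     = refl
map-unique⁻ f (z ∷ X) (fz∉ ∷ _)  (here refl) (there y∈X) fz≡fy = ⊥-elim (All.lookup fz∉ (∈-map⁺ f y∈X) fz≡fy)
map-unique⁻ f (z ∷ X) (fz∉ ∷ _)  (there x∈X) (here refl) fx≡fz = ⊥-elim (All.lookup fz∉ (∈-map⁺ f x∈X) (sym fx≡fz))
map-unique⁻ f (z ∷ X) (_ ∷ uX)   (there x∈X) (there y∈X) fx≡fy = map-unique⁻ f X uX x∈X y∈X fx≡fy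

-- Deciding propositional tautologies by truth tables

atoms< : ℕ → PForm → Bool
atoms< n (patom i)  = i <ᵇ n
atoms< n (pnot p)   = atoms< n p
atoms< n (pand p q) = atoms< n p ∧ atoms< n q

peval-local : ∀ n v w p → T (atoms< n p) → (∀ i → i < n → v i ≡ w i) → peval v p ≡ peval w p
peval-local n v w (patom i)  p<n agree = agree i (<ᵇ⇒< i n p<n)
peval-local n v w (pnot p)   p<n agree = cong not (peval-local n v w p p<n agree)
peval-local n v w (pand p q) pq<n agree =
  cong₂ _∧_ (peval-local n v w p (proj₁ bounds) agree) (peval-local n v w q (proj₂ bounds) agree)
  where
  bounds : T (atoms< n p) × T (atoms< n q)
  bounds = Equivalence.to T-∧ pq<n

peval-cong : ∀ v w p → (∀ i → v i ≡ w i) → peval v p ≡ peval w p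
peval-cong v w (patom i)  agree = agree i
peval-cong v w (pnot p)   agree = cong not (peval-cong v w p agree)
peval-cong v w (pand p q) agree = cong₂ _∧_ (peval-cong v w p agree) (peval-cong v w q agree)

update : (ℕ → Bool) → ℕ → Bool → ℕ → Bool
update v n b i with i ≟ n
... | yes _ = b
... | no  _ = v i

allExtensions : ℕ → (ℕ → Bool) → PForm → Bool
allExtensions zero    v p = peval v p
allExtensions (suc n) v p = allExtensions n (update v n true) p ∧ allExtensions n (update v n false) p

allExtensions-sound : ∀ n v p → T (allExtensions n v p) →
                      ∀ w → (∀ i → n ≤ i → w i ≡ v i) → T (peval w p)
allExtensions-sound zero v p ok w agree =
  subst T (peval-cong v w p (λ i → sym (agree i z≤n))) ok
allExtensions-sound (suc n) v p ok w agree =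
  allExtensions-sound n (update v n (w n)) p (branch (w n)) w agree'
  where
  branch : ∀ b → T (allExtensions n (update v n b) p)
  branch true  = proj₁ (Equivalence.to T-∧ ok)
  branch false = proj₂ (Equivalence.to T-∧ ok)
  agree' : ∀ i → n ≤ i → w i ≡ update v n (w n) i
  agree' i n≤i with i ≟ n
  ... | yes refl = refl
  ... | no  i≢n  = agree i (≤∧≢⇒< n≤i (λ n≡i → i≢n (sym n≡i)))

tautology : ∀ n p → T (atoms< n p) → T (allExtensions n (λ _ → false) p) → Tautology p
tautology n p p<n ok w = Equivalence.to T-≡ (subst T (peval-local n w' w p p<n below) (allExtensions-sound n _ p ok w' above))
  where
  w' : ℕ → Bool
  w' i with i <? n
  ... | yes _ = w i
  ... | no  _ = false
  below : ∀ i → i < n → w' i ≡ w i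
  below i i<n with i <? n
  ... | yes _ = refl
  ... | no i≮n = ⊥-elim (i≮n i<n)
  above : ∀ i → n ≤ i → w' i ≡ false
  above i n≤i with i <? n
  ... | yes i<n = ⊥-elim (<⇒≱ i<n n≤i)
  ... | no _ = refl

infixr 5 _⇛_
_⇛_ : PForm → PForm → PForm
p ⇛ q = pnot (pand p (pnot q))

𝑎 𝑏 𝑐 𝑑 : PForm
𝑎 = patom 0
𝑏 = patom 1
𝑐 = patom 2
𝑑 = patom 3

letters : Form → Form → Form → Form → ℕ → Form
letters A B C E 0 = A
letters A B C E 1 = B
letters A B C E 2 = C
letters A B C E _ = E

scheme : ∀ p → T (atoms< 4 p) → T (allExtensions 4 (λ _ → false) p) →
         ∀ A B C E → ⊢ instantiate (letters A B C E) p
scheme p p<4 ok A B C E = ax-taut (letters A B C E) p (tautology 4 p p<4 ok)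

⊢K : ∀ A B → ⊢ (A ⇒' (B ⇒' A))
⊢K A B = scheme (𝑎 ⇛ 𝑏 ⇛ 𝑎) _ _ A B A A

⊢I : ∀ A → ⊢ (A ⇒' A)
⊢I A = scheme (𝑎 ⇛ 𝑎) _ _ A A A A

⊢S : ∀ A B C E → ⊢ ((A ⇒' B ⇒' C) ⇒' (E ⇒' A) ⇒' (E ⇒' B) ⇒' (E ⇒' C))
⊢S A B C E = scheme ((𝑎 ⇛ 𝑏 ⇛ 𝑐) ⇛ (𝑑 ⇛ 𝑎) ⇛ (𝑑 ⇛ 𝑏) ⇛ (𝑑 ⇛ 𝑐)) _ _ A B C E

⊢W : ∀ A B C → ⊢ ((A ⇒' B) ⇒' A ⇒' C ⇒' B)
⊢W A B C = scheme ((𝑎 ⇛ 𝑏) ⇛ 𝑎 ⇛ 𝑐 ⇛ 𝑏) _ _ A B C A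

⊢cases : ∀ A B → ⊢ ((A ⇒' B) ⇒' (¬' A ⇒' B) ⇒' B)
⊢cases A B = scheme ((𝑎 ⇛ 𝑏) ⇛ (pnot 𝑎 ⇛ 𝑏) ⇛ 𝑏) _ _ A B A A

⊢∧I : ∀ A B → ⊢ (A ⇒' B ⇒' (A ∧' B))
⊢∧I A B = scheme (𝑎 ⇛ 𝑏 ⇛ pand 𝑎 𝑏) _ _ A B A A

⊢contra : ∀ A B C → ⊢ (((¬' A ∧' B) ⇒' ¬' C) ⇒' C ⇒' B ⇒' A)
⊢contra A B C = scheme ((pand (pnot 𝑎) 𝑏 ⇛ pnot 𝑐) ⇛ 𝑐 ⇛ 𝑏 ⇛ 𝑎) _ _ A B C A

⊢¬¬I : ∀ A → ⊢ (A ⇒' ¬' (¬' A))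
⊢¬¬I A = scheme (𝑎 ⇛ pnot (pnot 𝑎)) _ _ A A A A

⊢¬∧ˡ : ∀ A B → ⊢ (¬' A ⇒' ¬' (A ∧' B))
⊢¬∧ˡ A B = scheme (pnot 𝑎 ⇛ pnot (pand 𝑎 𝑏)) _ _ A B A A

⊢¬∧ʳ : ∀ A B → ⊢ (¬' B ⇒' ¬' (A ∧' B))
⊢¬∧ʳ A B = scheme (pnot 𝑏 ⇛ pnot (pand 𝑎 𝑏)) _ _ A B A A

-- Derivations from a list of hypotheses (deduction theorem style)

Imp : List Form → Form → Form
Imp []      ψ = ψ
Imp (γ ∷ Γ) ψ = γ ⇒' Imp Γ ψ

infix 3 _⊢ₕ_
_⊢ₕ_ : List Form → Form → Set
Γ ⊢ₕ ψ = ⊢ Imp Γ ψ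

weaken : ∀ Γ {ψ} → ⊢ ψ → Γ ⊢ₕ ψ
weaken []      d = d
weaken (γ ∷ Γ) d = mp (weaken Γ d) (⊢K _ γ)

mp-under : ∀ Γ {ψ χ} → Γ ⊢ₕ (ψ ⇒' χ) → Γ ⊢ₕ ψ → Γ ⊢ₕ χ
mp-under Γ dψχ dψ = mp dψ (mp dψχ (distribute Γ))
  where
  distribute : ∀ Γ {ψ χ} → ⊢ (Imp Γ (ψ ⇒' χ) ⇒' Imp Γ ψ ⇒' Imp Γ χ)
  distribute []      = ⊢I _
  distribute (γ ∷ Γ) = mp (distribute Γ) (⊢S _ _ _ γ)

assumption : ∀ Γ {ψ} → ψ ∈ Γ → Γ ⊢ₕ ψ
assumption (γ ∷ Γ) (here refl) = ⊢ψ⇒Imp Γ γ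
  where
  ⊢ψ⇒Imp : ∀ Γ ψ → ⊢ (ψ ⇒' Imp Γ ψ)
  ⊢ψ⇒Imp []      ψ = ⊢I ψ
  ⊢ψ⇒Imp (γ ∷ Γ) ψ = mp (⊢ψ⇒Imp Γ ψ) (⊢W ψ (Imp Γ ψ) γ)
assumption (γ ∷ Γ) (there ψ∈Γ) = mp (assumption Γ ψ∈Γ) (⊢K _ γ)

infer₁ : ∀ Γ {A B} → ⊢ (A ⇒' B) → Γ ⊢ₕ A → Γ ⊢ₕ B
infer₁ Γ t a = mp-under Γ (weaken Γ t) a

infer₂ : ∀ Γ {A B C} → ⊢ (A ⇒' B ⇒' C) → Γ ⊢ₕ A → Γ ⊢ₕ B → Γ ⊢ₕ C
infer₂ Γ t a b = mp-under Γ (mp-under Γ (weaken Γ t) a) b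

literal : Form → Bool → Form
literal a true  = a
literal a false = ¬' a

literals : List Form → List Bool → List Form
literals []       _        = []
literals (a ∷ As) []       = []
literals (a ∷ As) (b ∷ bs) = literal a b ∷ literals As bs

by-cases : ∀ As ψ → (∀ bs → length bs ≡ length As → literals As bs ⊢ₕ ψ) → ⊢ ψ
by-cases []       ψ H = H [] refl
by-cases (a ∷ As) ψ H = by-cases As ψ λ bs len →
  mp (H (false ∷ bs) (cong suc len)) (mp (H (true ∷ bs) (cong suc len)) (⊢cases a (Imp (literals As bs) ψ)))

literals-decide : ∀ As bs → length bs ≡ length As →
                  ∀ {a} → a ∈ As → a ∈ literals As bs ⊎ (¬' a) ∈ literals As bs
literals-decide (a ∷ As) (true  ∷ bs) _   (here refl) = inj₁ (here refl)
literals-decide (a ∷ As) (false ∷ bs) _   (here refl) = inj₂ (here refl)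
literals-decide (a ∷ As) (b ∷ bs)     len (there a∈As) with literals-decide As bs (suc-injective len) a∈As
... | inj₁ pos = inj₁ (there pos)
... | inj₂ neg = inj₂ (there neg)

rnVar-hit : ∀ y x → rnVar y x y ≡ x
rnVar-hit y x with y ≟ y
... | yes _   = refl
... | no  y≢y = ⊥-elim (y≢y refl)

rnVar-miss : ∀ y x z → z ≢ y → rnVar y x z ≡ z
rnVar-miss y x z z≢y with z ≟ y
... | yes z≡y = ⊥-elim (z≢y z≡y)
... | no  _   = refl

rnVar-self : ∀ y x → rnVar y x x ≡ x
rnVar-self y x with x ≟ y
... | yes _ = refl
... | no  _ = refl

-- alloc mentions the variable 0 (inside ⊥'), so replacement commutes with it only for y ≠ 0
replace-alloc : ∀ y x z → y ≢ 0 → replace y x (alloc z) ≡ alloc (rnVar y x z)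
replace-alloc y x z y≢0 rewrite rnVar-miss y x 0 (λ 0≡y → y≢0 (sym 0≡y)) = refl

module Rules (Γ : List Form) where

  ∧-intro : ∀ {A B} → Γ ⊢ₕ A → Γ ⊢ₕ B → Γ ⊢ₕ (A ∧' B)
  ∧-intro = infer₂ Γ (⊢∧I _ _)

  forward : ∀ {P E Q} → ⊢ ((P ∧' E) ⇒' Q) → Γ ⊢ₕ P → Γ ⊢ₕ E → Γ ⊢ₕ Q
  forward t dP dE = infer₁ Γ t (∧-intro dP dE)

  backward : ∀ {P E Q} → ⊢ ((¬' P ∧' E) ⇒' ¬' Q) → Γ ⊢ₕ Q → Γ ⊢ₕ E → Γ ⊢ₕ P
  backward t dQ dE = infer₂ Γ (mp t (⊢contra _ _ _)) dQ dE

  ≐-refl : ∀ x → Γ ⊢ₕ (x ≐ x)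
  ≐-refl x = weaken Γ (ax-refl x)

  ⊤-intro : Γ ⊢ₕ ⊤'
  ⊤-intro = infer₁ Γ (⊢¬¬I _) (≐-refl 0)

  subst-ax : ∀ φ x y {φ'} → replace y x φ ≡ φ' → ⊢ ((φ ∧' (x ≐ y)) ⇒' φ')
  subst-ax φ x y refl = ax-subst φ x y

  ≐-sym : ∀ {a b} → Γ ⊢ₕ (a ≐ b) → Γ ⊢ₕ (b ≐ a)
  ≐-sym {a} {b} dab = backward (subst-ax (¬' (b ≐ a)) a b (cong ¬'_ (cong₂ _≐_ (rnVar-hit b a) (rnVar-self b a)))) (≐-refl a) dab

  module Leibniz (op : PVAR → PVAR → Form)
                 (replace-op : ∀ y x a b → replace y x (op a b) ≡ op (rnVar y x a) (rnVar y x b)) where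

    -- If c ≠ a, axiom (2) replaces a by b in op a c.  If c = a it would rename both arguments,
    -- so axiom (2) is used contrapositively: replacing b by a in ¬ op b a gives ¬ op a a.
    congˡ : ∀ {a b c} → Γ ⊢ₕ (a ≐ b) → Γ ⊢ₕ op a c → Γ ⊢ₕ op b c
    congˡ {a} {b} {c} dab dac with a ≟ b | c ≟ a
    ... | yes refl | _        = dac
    ... | no  _    | no  c≢a  = forward (subst-ax (op a c) b a renamed) dac (≐-sym dab)
      where
      renamed : replace a b (op a c) ≡ op b c
      renamed = trans (replace-op a b a c) (cong₂ op (rnVar-hit a b) (rnVar-miss a b c c≢a))
    ... | no  _    | yes refl = backward (subst-ax (¬' op b c) c b (cong ¬'_ renamed)) dac dab
      where
      renamed : replace b c (op b c) ≡ op c c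
      renamed = trans (replace-op b c b c) (cong₂ op (rnVar-hit b c) (rnVar-self b c))

    congʳ : ∀ {a b c} → Γ ⊢ₕ (b ≐ c) → Γ ⊢ₕ op a b → Γ ⊢ₕ op a c
    congʳ {a} {b} {c} dbc dab with b ≟ c | a ≟ b
    ... | yes refl | _        = dab
    ... | no  _    | no  a≢b  = forward (subst-ax (op a b) c b renamed) dab (≐-sym dbc)
      where
      renamed : replace b c (op a b) ≡ op a c
      renamed = trans (replace-op b c a b) (cong₂ op (rnVar-miss b c a a≢b) (rnVar-hit b c))
    ... | no  _    | yes refl = backward (subst-ax (¬' op a c) a c (cong ¬'_ renamed)) dab dbc
      where
      renamed : replace c a (op a c) ≡ op a a
      renamed = trans (replace-op c a a c) (cong₂ op (rnVar-self c a) (rnVar-hit c a))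

  open Leibniz _≐_ (λ _ _ _ _ → refl) using () renaming (congʳ to ≐-trans')
  open Leibniz _↪_ (λ _ _ _ _ → refl) public renaming (congˡ to ↪-congˡ; congʳ to ↪-congʳ)

  ≐-trans : ∀ {a b c} → Γ ⊢ₕ (a ≐ b) → Γ ⊢ₕ (b ≐ c) → Γ ⊢ₕ (a ≐ c)
  ≐-trans dab dbc = ≐-trans' dbc dab

  -- as for congˡ; the case a = 0 is separate because alloc mentions the variable 0
  alloc-cong : ∀ {a b} → Γ ⊢ₕ (a ≐ b) → Γ ⊢ₕ alloc a → Γ ⊢ₕ alloc b
  alloc-cong {a} {b} dab da with a ≟ b | a ≟ 0
  ... | yes refl | _        = da
  ... | no  _    | no  a≢0  = forward (subst-ax (alloc a) b a renamed) da (≐-sym dab)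
    where
    renamed : replace a b (alloc a) ≡ alloc b
    renamed = trans (replace-alloc a b a a≢0) (cong alloc (rnVar-hit a b))
  ... | no  a≢b  | yes refl = backward (subst-ax (¬' alloc b) 0 b (cong ¬'_ renamed)) da dab
    where
    renamed : replace b 0 (alloc b) ≡ alloc 0
    renamed = trans (replace-alloc b 0 b (λ b≡0 → a≢b (sym b≡0))) (cong alloc (rnVar-hit b 0))

  ↪-functional : ∀ {x y z} → Γ ⊢ₕ (x ↪ y) → Γ ⊢ₕ (x ↪ z) → Γ ⊢ₕ (y ≐ z)
  ↪-functional {x} {y} {z} dy dz = infer₁ Γ (ax-fun x y z) (∧-intro dy dz)

  ↪⇒alloc : ∀ {x y} → Γ ⊢ₕ (x ↪ y) → Γ ⊢ₕ alloc x
  ↪⇒alloc {x} {y} = infer₁ Γ (ax-alloc x y)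

  size-mono : ∀ β γ → β ≤ γ → Γ ⊢ₕ size≥ γ → Γ ⊢ₕ size≥ β
  size-mono zero    γ       _   _ = ⊤-intro
  size-mono (suc β) (suc γ) β<γ d with suc β ≟ suc γ
  ... | yes refl = d
  ... | no  β≢γ  = size-mono (suc β) γ (≤-pred (≤∧≢⇒< β<γ β≢γ)) (infer₁ Γ (ax-size γ) d)

rnVar-sem : ∀ (s : Store) x y z → s x ≡ s y → s (rnVar y x z) ≡ s z
rnVar-sem s x y z sx≡sy with z ≟ y
... | yes refl = sx≡sy
... | no  _    = refl

replace-sem : ∀ φ s h x y → s x ≡ s y →
              (s , h ⊨ φ → s , h ⊨ replace y x φ) × (s , h ⊨ replace y x φ → s , h ⊨ φ)
replace-sem (a ≐ b) s h x y e rewrite rnVar-sem s x y a e | rnVar-sem s x y b e = (λ p → p) , (λ p → p)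
replace-sem (a ↪ b) s h x y e rewrite rnVar-sem s x y a e | rnVar-sem s x y b e = (λ p → p) , (λ p → p)
replace-sem emp      s h x y e = (λ p → p) , (λ p → p)
replace-sem (¬' φ)   s h x y e =
  (λ ¬p p → ¬p (proj₂ (replace-sem φ s h x y e) p)) , (λ ¬p p → ¬p (proj₁ (replace-sem φ s h x y e) p))
replace-sem (φ ∧' ψ) s h x y e =
  (λ (p , q) → proj₁ (replace-sem φ s h x y e) p , proj₁ (replace-sem ψ s h x y e) q) ,
  (λ (p , q) → proj₂ (replace-sem φ s h x y e) p , proj₂ (replace-sem ψ s h x y e) q)
replace-sem (φ *' ψ) s h x y e =
  (λ (h₁ , h₂ , split , p , q) → h₁ , h₂ , split , proj₁ (replace-sem φ s h₁ x y e) p , proj₁ (replace-sem ψ s h₂ x y e) q) ,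
  (λ (h₁ , h₂ , split , p , q) → h₁ , h₂ , split , proj₂ (replace-sem φ s h₁ x y e) p , proj₂ (replace-sem ψ s h₂ x y e) q)
replace-sem (φ -* ψ) s h x y e =
  (λ w h₁ h' split p → proj₁ (replace-sem ψ s h' x y e) (w h₁ h' split (proj₂ (replace-sem φ s h₁ x y e) p))) ,
  (λ w h₁ h' split p → proj₂ (replace-sem ψ s h' x y e) (w h₁ h' split (proj₁ (replace-sem φ s h₁ x y e) p)))

singleton : LOC → LOC → Heap
singleton l v = record { at = cell ; finite = suc l , vanish }
  where
  cell : LOC → Maybe LOC
  cell l' with l' ≟ l
  ... | yes _ = just v
  ... | no  _ = nothing
  vanish : ∀ l' → suc l ≤ l' → cell l' ≡ nothing
  vanish l' l<l' with l' ≟ l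
  ... | yes refl = ⊥-elim (<-irrefl refl l<l')
  ... | no  _    = refl

extend : Heap → LOC → LOC → Heap
extend h l v = record { at = cell ; finite = suc l ⊔ b , vanish }
  where
  b : ℕ
  b = proj₁ (finite h)
  cell : LOC → Maybe LOC
  cell l' with l' ≟ l
  ... | yes _ = just v
  ... | no  _ = at h l'
  vanish : ∀ l' → suc l ⊔ b ≤ l' → cell l' ≡ nothing
  vanish l' bound≤l' with l' ≟ l
  ... | yes refl = ⊥-elim (<-irrefl refl (≤-trans (m≤m⊔n (suc l) b) bound≤l'))
  ... | no  _    = proj₂ (finite h) l' (≤-trans (m≤n⊔m (suc l) b) bound≤l')

extend-split : ∀ h l v → at h l ≡ nothing → Split (extend h l v) h (singleton l v)
extend-split h l v free l' with l' ≟ l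
... | yes refl = inj₂ (refl , free)
... | no  _    = inj₁ (refl , refl)

singleton-at : ∀ l v → at (singleton l v) l ≡ just v
singleton-at l v with l ≟ l
... | yes _   = refl
... | no  l≢l = ⊥-elim (l≢l refl)

Allocated : Heap → LOC → Set
Allocated h l = at h l ≢ nothing

just≢nothing : ∀ {v : LOC} → just v ≢ nothing
just≢nothing ()

Cells≥ : Heap → ℕ → Set
Cells≥ h n = Σ (List LOC) λ L → length L ≡ n × Unique L × All (Allocated h) L

Cells≥-pred : ∀ {h n} → Cells≥ h (suc n) → Cells≥ h n
Cells≥-pred (l ∷ L , len , _ ∷ uL , _ ∷ allocL) = L , suc-injective len , uL , allocL

Cells≥-mono : ∀ {h} β γ → β ≤ γ → Cells≥ h γ → Cells≥ h β
Cells≥-mono {h} β zero    z≤n cells = cells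
Cells≥-mono {h} β (suc γ) β≤γ cells with β ≟ suc γ
... | yes refl = cells
... | no  β≢γ  = Cells≥-mono {h} β γ (≤-pred (≤∧≢⇒< β≤γ β≢γ)) (Cells≥-pred {h} cells)

AllCore : (∀ {a} → Core a → Set) → ∀ {φ} → BoolComb φ → Set
AllCore P (bc-core c)    = P c
AllCore P (bc-not b)     = AllCore P b
AllCore P (bc-and b₁ b₂) = AllCore P b₁ × AllCore P b₂

AllCore-map : ∀ {P Q : ∀ {a} → Core a → Set} → (∀ {a} (c : Core a) → P c → Q c) →
              ∀ {φ} (bc : BoolComb φ) → AllCore P bc → AllCore Q bc
AllCore-map f (bc-core c)    p         = f c p
AllCore-map f (bc-not b)     p         = AllCore-map f b p
AllCore-map f (bc-and b₁ b₂) (p₁ , p₂) = AllCore-map f b₁ p₁ , AllCore-map f b₂ p₂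

core-atoms : ∀ {φ} → BoolComb φ → List Form
core-atoms {φ} (bc-core _)  = φ ∷ []
core-atoms (bc-not b)       = core-atoms b
core-atoms (bc-and b₁ b₂)   = core-atoms b₁ ++ core-atoms b₂

core-atoms-complete : ∀ {φ} (bc : BoolComb φ) → AllCore (λ {a} _ → a ∈ core-atoms bc) bc
core-atoms-complete (bc-core c)    = here refl
core-atoms-complete (bc-not b)     = core-atoms-complete b
core-atoms-complete (bc-and b₁ b₂) =
  AllCore-map (λ _ → ∈-++⁺ˡ) b₁ (core-atoms-complete b₁) ,
  AllCore-map (λ _ → ∈-++⁺ʳ (core-atoms b₁)) b₂ (core-atoms-complete b₂)

Bounded : ℕ → ∀ {a} → Core a → Set
Bounded N (core-eq x y)  = ⊤
Bounded N (core-alloc x) = x < N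
Bounded N (core-pt x y)  = x < N × y < N
Bounded N (core-size β)  = β ≤ N

Bounded-mono : ∀ {N N' a} (c : Core a) → N ≤ N' → Bounded N c → Bounded N' c
Bounded-mono (core-eq x y)  _    _           = tt
Bounded-mono (core-alloc x) N≤N' x<N         = <-≤-trans x<N N≤N'
Bounded-mono (core-pt x y)  N≤N' (x<N , y<N) = <-≤-trans x<N N≤N' , <-≤-trans y<N N≤N'
Bounded-mono (core-size β)  N≤N' β≤N         = ≤-trans β≤N N≤N'

bound : ∀ {φ} → BoolComb φ → ℕ
bound (bc-core (core-eq x y))  = 0
bound (bc-core (core-alloc x)) = suc x
bound (bc-core (core-pt x y))  = suc x ⊔ suc y
bound (bc-core (core-size β))  = β
bound (bc-not b)               = bound b
bound (bc-and b₁ b₂)           = bound b₁ ⊔ bound b₂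

bound-bounds : ∀ {φ} (bc : BoolComb φ) → AllCore (Bounded (bound bc)) bc
bound-bounds (bc-core (core-eq x y))  = tt
bound-bounds (bc-core (core-alloc x)) = ≤-refl
bound-bounds (bc-core (core-pt x y))  = m≤m⊔n (suc x) (suc y) , m≤n⊔m (suc x) (suc y)
bound-bounds (bc-core (core-size β))  = ≤-refl
bound-bounds (bc-not b)               = bound-bounds b
bound-bounds (bc-and b₁ b₂) =
  AllCore-map (λ c → Bounded-mono c (m≤m⊔n (bound b₁) (bound b₂))) b₁ (bound-bounds b₁) ,
  AllCore-map (λ c → Bounded-mono c (m≤n⊔m (bound b₁) (bound b₂))) b₂ (bound-bounds b₂)

module Classical (em : ExcludedMiddle 0ℓ) where

  dne : {P : Set} → ¬ ¬ P → P
  dne {P} ¬¬p with em {P}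
  ... | yes p  = p
  ... | no  ¬p = ⊥-elim (¬¬p ¬p)

  restrict : Heap → (LOC → Set) → Heap
  restrict h P = record { at = cell ; finite = proj₁ (finite h) , vanish }
    where
    cell : LOC → Maybe LOC
    cell l with em {P l}
    ... | yes _ = at h l
    ... | no  _ = nothing
    vanish : ∀ l → proj₁ (finite h) ≤ l → cell l ≡ nothing
    vanish l b≤l with em {P l}
    ... | yes _ = proj₂ (finite h) l b≤l
    ... | no  _ = refl

  restrict-in : ∀ h P l → P l → at (restrict h P) l ≡ at h l
  restrict-in h P l p with em {P l}
  ... | yes _  = refl
  ... | no  ¬p = ⊥-elim (¬p p)

  restrict-out : ∀ h P l → ¬ P l → at (restrict h P) l ≡ nothing
  restrict-out h P l ¬p with em {P l}
  ... | yes p = ⊥-elim (¬p p)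
  ... | no  _ = refl

  restrict-split : ∀ h P → Split h (restrict h P) (restrict h (λ l → ¬ P l))
  restrict-split h P l with em {P l}
  ... | yes p  = inj₁ (refl , restrict-out h (λ l → ¬ P l) l (λ ¬p → ¬p p))
  ... | no  ¬p = inj₂ (sym (restrict-in h (λ l → ¬ P l) l ¬p) , refl)

  -- alloc x holds iff s x is allocated: a cell x ↦ x can be added disjointly exactly when it is not
  alloc-sem⇒ : ∀ s h x → s , h ⊨ alloc x → Allocated h (s x)
  alloc-sem⇒ s h x ⊨alloc free =
    ⊨alloc (singleton (s x) (s x)) (extend h (s x) (s x)) (extend-split h (s x) (s x) free) (singleton-at (s x) (s x)) refl

  alloc-sem⇐ : ∀ s h x → Allocated h (s x) → s , h ⊨ alloc x
  alloc-sem⇐ s h x allocated h₁ h' split x↦x _ with split (s x)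
  ... | inj₁ (_ , h₁-free) = just≢nothing (trans (sym x↦x) h₁-free)
  ... | inj₂ (_ , h-free)  = allocated h-free

  nonempty : ∀ s h → s , h ⊨ (¬' emp) → ∃ (Allocated h)
  nonempty s h ¬emp = dne λ none → ¬emp λ l → dne λ allocated → none (l , allocated)

  size-sem⇒ : ∀ β s h → s , h ⊨ size≥ β → Cells≥ h β
  size-sem⇒ zero          s h _ = [] , refl , [] , []
  size-sem⇒ (suc zero)    s h ¬emp with nonempty s h ¬emp
  ... | l , allocated = l ∷ [] , refl , [] ∷ [] , allocated ∷ []
  size-sem⇒ (suc (suc β)) s h (h₁ , h₂ , split , ¬emp₁ , size₂)
    with nonempty s h₁ ¬emp₁ | size-sem⇒ (suc β) s h₂ size₂
  ... | l , allocated₁ | L , len , uL , allocL =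
    l ∷ L , cong suc len , All.map l∉h₂ allocL ∷ uL , in-h₁ ∷ All.map in-h₂ allocL
    where
    in-h₁ : Allocated h l
    in-h₁ with split l
    ... | inj₁ (h≡h₁ , _) = subst (λ c → c ≢ nothing) (sym h≡h₁) allocated₁
    ... | inj₂ (_ , h₁-free) = ⊥-elim (allocated₁ h₁-free)
    in-h₂ : ∀ {l'} → Allocated h₂ l' → Allocated h l'
    in-h₂ {l'} allocated₂ with split l'
    ... | inj₁ (_ , h₂-free) = ⊥-elim (allocated₂ h₂-free)
    ... | inj₂ (h≡h₂ , _)    = subst (λ c → c ≢ nothing) (sym h≡h₂) allocated₂
    l∉h₂ : ∀ {l'} → Allocated h₂ l' → l ≢ l'
    l∉h₂ allocated₂ refl with split l
    ... | inj₁ (_ , h₂-free) = allocated₂ h₂-free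
    ... | inj₂ (_ , h₁-free) = allocated₁ h₁-free

  size-sem⇐ : ∀ β s h → Cells≥ h β → s , h ⊨ size≥ β
  size-sem⇐ zero          s h _ = λ ⊨⊥ → ⊨⊥ refl
  size-sem⇐ (suc zero)    s h (l ∷ [] , _ , _ , allocated ∷ []) = λ empty → allocated (empty l)
  size-sem⇐ (suc (suc β)) s h (l ∷ L , len , l∉L ∷ uL , allocated ∷ allocL) =
    restrict h (_≡ l) , restrict h (λ l' → ¬ l' ≡ l) , restrict-split h (_≡ l) ,
    (λ empty → allocated (trans (sym (restrict-in h (_≡ l) l refl)) (empty l))) ,
    size-sem⇐ (suc β) s _ (L , suc-injective len , uL , All.zipWith in-rest (l∉L , allocL))
    where
    in-rest : ∀ {l'} → l ≢ l' × Allocated h l' → Allocated (restrict h (λ l' → ¬ l' ≡ l)) l'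
    in-rest {l'} (l≢l' , allocated') =
      subst (λ c → c ≢ nothing) (sym (restrict-in h _ l' (λ l'≡l → l≢l' (sym l'≡l)))) allocated'

  instantiate-reflects : ∀ s h σ p →
    Reflects (s , h ⊨ instantiate σ p) (peval (λ n → does (em {s , h ⊨ σ n})) p)
  instantiate-reflects s h σ (patom n)  = proof (em {s , h ⊨ σ n})
  instantiate-reflects s h σ (pnot p)   = ¬-reflects (instantiate-reflects s h σ p)
  instantiate-reflects s h σ (pand p q) = instantiate-reflects s h σ p ×-reflects instantiate-reflects s h σ q

  ⋀-sem : ∀ s h (f : PVAR → Form) X → s , h ⊨ ⋀ (mapF f X) → ∀ {x} → x ∈ X → s , h ⊨ f x
  ⋀-sem s h f (x ∷ X) (fx , _)   (here refl) = fx
  ⋀-sem s h f (x ∷ X) (_ , rest) (there x∈X) = ⋀-sem s h f X rest x∈X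

  soundness : ∀ {φ} → ⊢ φ → Valid φ
  soundness (ax-taut σ p taut) s h = invert (subst (Reflects _) (taut _) (instantiate-reflects s h σ p))
  soundness (mp dφ dφ⇒ψ) s h = dne λ ¬ψ → soundness dφ⇒ψ s h (soundness dφ s h , ¬ψ)
  soundness (ax-refl x) s h = refl
  soundness (ax-subst φ x y) s h ((p , sx≡sy) , ¬p') = ¬p' (proj₁ (replace-sem φ s h x y sx≡sy) p)
  soundness (ax-alloc x y) s h (x↦y , ¬alloc) =
    ¬alloc (alloc-sem⇐ s h x λ free → just≢nothing (trans (sym x↦y) free))
  soundness (ax-fun x y z) s h ((x↦y , x↦z) , y≢z) = y≢z (just-injective (trans (sym x↦y) x↦z))
  soundness (ax-size β) s h (size , ¬size) =
    ¬size (size-sem⇐ β s h (Cells≥-pred {h} (size-sem⇒ (suc β) s h size)))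
  soundness (ax-fin X uX) s h (allocDistinct , ¬size) =
    ¬size (size-sem⇐ (length X) s h
             (map s X , length-map s X , map-unique s X uX distinct , Allₚ.map⁺ (All.tabulate allocated)))
    where
    clause : ∀ {x} → x ∈ X → s , h ⊨ (alloc x ∧' ⋀ (mapF (λ y → ¬' (x ≐ y)) (minus X x)))
    clause = ⋀-sem s h _ X allocDistinct
    allocated : ∀ {x} → x ∈ X → Allocated h (s x)
    allocated x∈X = alloc-sem⇒ s h _ (proj₁ (clause x∈X))
    distinct : ∀ {x y} → x ∈ X → y ∈ X → x ≢ y → s x ≢ s y
    distinct {x} x∈X y∈X x≢y =
      ⋀-sem s h (λ y → ¬' (x ≐ y)) (minus X x) (proj₂ (clause x∈X))
            (∈-filter⁺ (λ y → ¬? (y ≟ x)) y∈X (λ y≡x → x≢y (sym y≡x)))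

  record Least (P : ℕ → Set) : Set where
    field
      value   : ℕ
      holds   : P value
      minimal : ∀ m → m < value → ¬ P m

  search-least : ∀ (P : ℕ → Set) k → (Σ (Least P) λ w → Least.value w ≤ k) ⊎ (∀ m → m ≤ k → ¬ P m)
  search-least P zero with em {P zero}
  ... | yes p0 = inj₁ (record { value = 0 ; holds = p0 ; minimal = λ _ () } , z≤n)
  ... | no ¬p0 = inj₂ λ { zero z≤n → ¬p0 }
  search-least P (suc k) with search-least P k | em {P (suc k)}
  ... | inj₁ (w , w≤k) | _     = inj₁ (w , ≤-trans w≤k (n≤1+n k))
  ... | inj₂ none      | yes p =
    inj₁ (record { value = suc k ; holds = p ; minimal = λ m m<1+k → none m (≤-pred m<1+k) } , ≤-refl)
  ... | inj₂ none      | no ¬p = inj₂ λ m m≤1+k → case (m ≟ suc k) m≤1+k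
    where
    case : ∀ {m} → Dec (m ≡ suc k) → m ≤ suc k → ¬ P m
    case (yes refl) _     = ¬p
    case (no  m≢)   m≤1+k = none _ (≤-pred (≤∧≢⇒< m≤1+k m≢))

  least : ∀ (P : ℕ → Set) k → P k → Σ (Least P) λ w → Least.value w ≤ k
  least P k pk with search-least P k
  ... | inj₁ found = found
  ... | inj₂ none  = ⊥-elim (none k ≤-refl pk)

  greatest : ∀ (P : ℕ → Set) k → P 0 → Σ ℕ λ n → P n × (∀ m → m ≤ k → P m → m ≤ n)
  greatest P zero    p0 = 0 , p0 , λ { m z≤n _ → z≤n }
  greatest P (suc k) p0 with em {P (suc k)} | greatest P k p0
  ... | yes p  | _            = suc k , p , λ m m≤1+k _ → m≤1+k
  ... | no  ¬p | n , pn , max = n , pn , λ m m≤1+k pm → max m (below (m ≟ suc k) m≤1+k pm) pm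
    where
    below : ∀ {m} → Dec (m ≡ suc k) → m ≤ suc k → P m → m ≤ k
    below (yes refl) _     pm = ⊥-elim (¬p pm)
    below (no  m≢)   m≤1+k _  = ≤-pred (≤∧≢⇒< m≤1+k m≢)

  module CanonicalModel (Γ : List Form) (N : ℕ)
         (≐-decided : ∀ x y → x < N → y < N → Γ ⊢ₕ (x ≐ y) ⊎ Γ ⊢ₕ ¬' (x ≐ y)) where
    open Rules Γ

    least-equal : ∀ x → Σ (Least λ n → Γ ⊢ₕ (x ≐ n)) λ w → Least.value w ≤ x
    least-equal x = least _ x (≐-refl x)

    s : Store
    s x = Least.value (proj₁ (least-equal x))

    x≐sx : ∀ x → Γ ⊢ₕ (x ≐ s x)
    x≐sx x = Least.holds (proj₁ (least-equal x))

    s<N : ∀ {x} → x < N → s x < N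
    s<N {x} = ≤-<-trans (proj₂ (least-equal x))

    -- Γ ⊢ x ≐ y iff s x = s y; the forward direction uses the minimality of s
    s-sound : ∀ {x y} → Γ ⊢ₕ (x ≐ y) → s x ≡ s y
    s-sound {x} {y} x≐y with <-cmp (s x) (s y)
    ... | tri< sx<sy _ _ = ⊥-elim (Least.minimal (proj₁ (least-equal y)) (s x) sx<sy (≐-trans (≐-sym x≐y) (x≐sx x)))
    ... | tri≈ _ sx≡sy _ = sx≡sy
    ... | tri> _ _ sy<sx = ⊥-elim (Least.minimal (proj₁ (least-equal x)) (s y) sy<sx (≐-trans x≐y (x≐sx y)))

    s-complete : ∀ {x y} → s x ≡ s y → Γ ⊢ₕ (x ≐ y)
    s-complete {x} {y} sx≡sy = ≐-trans (x≐sx x) (≐-sym (subst (λ l → Γ ⊢ₕ (y ≐ l)) (sym sx≡sy) (x≐sx y)))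

    allocated-vars : List PVAR
    allocated-vars = filter (λ x → em {Γ ⊢ₕ alloc x}) (upTo N)

    same-location : DecSetoid 0ℓ 0ℓ
    same-location = On.decSetoid ≡-decSetoid s

    same-location? : ∀ x y → Dec (s x ≡ s y)
    same-location? = DecSetoid._≟_ same-location

    R : List PVAR
    R = deduplicate same-location? allocated-vars

    S : List LOC
    S = map s R

    S-unique : Unique S
    S-unique = AllPairs.map⁺ (deduplicate-! same-location allocated-vars)

    R-allocated : ∀ {x} → x ∈ R → x < N × Γ ⊢ₕ alloc x
    R-allocated x∈R with ∈-filter⁻ (λ x → em {Γ ⊢ₕ alloc x}) (∈-deduplicate⁻ same-location? allocated-vars x∈R)
    ... | x∈upTo , alloc-x = ∈-upTo⁻ x∈upTo , alloc-x

    allocated⇒represented : ∀ {x} → x < N → Γ ⊢ₕ alloc x → s x ∈ S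
    allocated⇒represented {x} x<N alloc-x
      with find (Anyₚ.deduplicate⁺ same-location? (λ sb≡sa sa≡sx → trans sb≡sa sa≡sx)
                   (Any.map (λ x≡z → cong s (sym x≡z))
                      (∈-filter⁺ (λ x → em {Γ ⊢ₕ alloc x}) (∈-upTo⁺ x<N) alloc-x)))
    ... | x' , x'∈R , sx'≡sx = subst (_∈ S) sx'≡sx (∈-map⁺ s x'∈R)

    size-bound : Σ ℕ λ T → Γ ⊢ₕ size≥ T × (∀ β → β ≤ N → Γ ⊢ₕ size≥ β → β ≤ T)
    size-bound = greatest (λ β → Γ ⊢ₕ size≥ β) N ⊤-intro

    derivable-size : ℕ
    derivable-size = proj₁ size-bound

    derivable-size-holds : Γ ⊢ₕ size≥ derivable-size
    derivable-size-holds = proj₁ (proj₂ size-bound)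

    derivable-size-max : ∀ β → β ≤ N → Γ ⊢ₕ size≥ β → β ≤ derivable-size
    derivable-size-max = proj₂ (proj₂ size-bound)

    -- axiom (6) for R: its variables are provably allocated, and provably distinct because Γ decides
    -- their equalities and their locations differ
    R-size : Γ ⊢ₕ size≥ (length R)
    R-size = infer₁ Γ (ax-fin R (Uniqueₚ.map⁻ S-unique)) (conjunction R λ {x} x∈R → ∧-intro (proj₂ (R-allocated x∈R))
               (conjunction (minus R x) λ y∈R∖x → distinct x∈R (∈-filter⁻ (λ y → ¬? (y ≟ x)) y∈R∖x)))
      where
      conjunction : ∀ {f : PVAR → Form} X → (∀ {x} → x ∈ X → Γ ⊢ₕ f x) → Γ ⊢ₕ ⋀ (mapF f X)
      conjunction []      _  = ⊤-intro
      conjunction (x ∷ X) dX = ∧-intro (dX (here refl)) (conjunction X (λ x∈X → dX (there x∈X)))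
      distinct : ∀ {x y} → x ∈ R → y ∈ R × y ≢ x → Γ ⊢ₕ ¬' (x ≐ y)
      distinct {x} {y} x∈R (y∈R , y≢x) with ≐-decided x y (proj₁ (R-allocated x∈R)) (proj₁ (R-allocated y∈R))
      ... | inj₂ x≢y = x≢y
      ... | inj₁ x≐y = ⊥-elim (y≢x (sym (map-unique⁻ s R S-unique x∈R y∈R (s-sound x≐y))))

    -- the heap has max(derivable-size, |R|) cells: the represented locations S, and Extra,
    -- the fresh locations N, N+1, … needed to reach that size
    size : ℕ
    size = derivable-size ⊔ length R

    fresh : ℕ
    fresh = size ∸ length R

    Extra : List LOC
    Extra = applyUpTo (N +_) fresh

    Extra-bounds : ∀ {l} → l ∈ Extra → N ≤ l × l < N + fresh
    Extra-bounds l∈Extra with ∈-applyUpTo⁻ (N +_) l∈Extra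
    ... | i , i<k , refl = m≤m+n N i , +-monoʳ-< N i<k

    Extra-unique : Unique Extra
    Extra-unique = Uniqueₚ.applyUpTo⁺₁ (N +_) _ λ i<j _ N+i≡N+j → <⇒≢ i<j (+-cancelˡ-≡ N _ _ N+i≡N+j)

    -- x's cell points to the value of a provable target y < N of x, or else to the location N,
    -- which is not the value of any variable below N
    data TargetView (x : PVAR) : LOC → Set where
      provable : ∀ y → y < N → Γ ⊢ₕ (x ↪ y) → TargetView x (s y)
      none     : (∀ y → y < N → ¬ (Γ ⊢ₕ (x ↪ y))) → TargetView x N

    target : PVAR → LOC
    target x with em {Σ ℕ λ y → y < N × Γ ⊢ₕ (x ↪ y)}
    ... | yes (y , _) = s y
    ... | no  _       = N

    target-view : ∀ x → TargetView x (target x)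
    target-view x with em {Σ ℕ λ y → y < N × Γ ⊢ₕ (x ↪ y)}
    ... | yes (y , y<N , x↪y) = provable y y<N x↪y
    ... | no  ¬target         = none λ y y<N x↪y → ¬target (y , y<N , x↪y)

    cell : LOC → Maybe LOC
    cell l with l ∈? S | l ∈? Extra
    ... | yes l∈S | _   = just (target (proj₁ (∈-map⁻ s l∈S)))
    ... | no  _   | yes _ = just 0
    ... | no  _   | no  _ = nothing

    data CellView (l : LOC) : Maybe LOC → Set where
      represented : ∀ x → x ∈ R → l ≡ s x → CellView l (just (target x))
      extra       : l ∉ S → l ∈ Extra → CellView l (just 0)
      free        : l ∉ S → l ∉ Extra → CellView l nothing

    cell-view : ∀ l → CellView l (cell l)
    cell-view l with l ∈? S | l ∈? Extra
    ... | yes l∈S | _         = represented _ (proj₁ (proj₂ (∈-map⁻ s l∈S))) (proj₂ (proj₂ (∈-map⁻ s l∈S)))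
    ... | no  l∉S | yes l∈Ex  = extra l∉S l∈Ex
    ... | no  l∉S | no  l∉Ex  = free l∉S l∉Ex

    S<N : ∀ {l} → l ∈ S → l < N
    S<N l∈S with ∈-map⁻ s l∈S
    ... | x , x∈R , refl = s<N (proj₁ (R-allocated x∈R))

    heap : Heap
    heap = record { at = cell ; finite = N + fresh , vanish }
      where
      vanish : ∀ l → N + fresh ≤ l → cell l ≡ nothing
      vanish l bound≤l with cell l | cell-view l
      ... | _ | represented x x∈R refl = ⊥-elim (<⇒≱ (S<N (∈-map⁺ s x∈R)) (≤-trans (m≤m+n N _) bound≤l))
      ... | _ | extra _ l∈Ex           = ⊥-elim (<⇒≱ (proj₂ (Extra-bounds l∈Ex)) bound≤l)
      ... | _ | free _ _               = refl

    target-correct : ∀ {x y} → y < N → Γ ⊢ₕ (x ↪ y) → target x ≡ s y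
    target-correct {x} y<N x↪y with target x | target-view x
    ... | _ | provable y' _ x↪y' = s-sound (↪-functional x↪y' x↪y)
    ... | _ | none no-target     = ⊥-elim (no-target _ y<N x↪y)

    target-complete : ∀ {x y} → y < N → target x ≡ s y → Γ ⊢ₕ (x ↪ y)
    target-complete {x} y<N with target x | target-view x
    ... | _ | provable y' _ x↪y' = λ sy'≡sy → ↪-congʳ (s-complete sy'≡sy) x↪y'
    ... | _ | none _             = λ N≡sy → ⊥-elim (<-irrefl (sym N≡sy) (s<N y<N))

    value∉Extra : ∀ {x} → x < N → s x ∉ Extra
    value∉Extra x<N sx∈Ex = <⇒≱ (s<N x<N) (proj₁ (Extra-bounds sx∈Ex))

    alloc-correct⇒ : ∀ {x} → x < N → Γ ⊢ₕ alloc x → Allocated heap (s x)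
    alloc-correct⇒ {x} x<N alloc-x with cell (s x) | cell-view (s x)
    ... | _ | represented _ _ _ = λ ()
    ... | _ | extra _ sx∈Ex     = ⊥-elim (value∉Extra x<N sx∈Ex)
    ... | _ | free sx∉S _       = ⊥-elim (sx∉S (allocated⇒represented x<N alloc-x))

    alloc-correct⇐ : ∀ {x} → x < N → Allocated heap (s x) → Γ ⊢ₕ alloc x
    alloc-correct⇐ {x} x<N with cell (s x) | cell-view (s x)
    ... | _ | represented x' x'∈R sx≡sx' = λ _ → alloc-cong (s-complete (sym sx≡sx')) (proj₂ (R-allocated x'∈R))
    ... | _ | extra _ sx∈Ex              = ⊥-elim (value∉Extra x<N sx∈Ex)
    ... | _ | free _ _                   = λ allocated → ⊥-elim (allocated refl)

    ↪-correct⇒ : ∀ {x y} → x < N → y < N → Γ ⊢ₕ (x ↪ y) → at heap (s x) ≡ just (s y)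
    ↪-correct⇒ {x} x<N y<N x↪y with cell (s x) | cell-view (s x)
    ... | _ | represented x' _ sx≡sx' = cong just (target-correct y<N (↪-congˡ (s-complete sx≡sx') x↪y))
    ... | _ | extra _ sx∈Ex           = ⊥-elim (value∉Extra x<N sx∈Ex)
    ... | _ | free sx∉S _             = ⊥-elim (sx∉S (allocated⇒represented x<N (↪⇒alloc x↪y)))

    ↪-correct⇐ : ∀ {x y} → x < N → y < N → at heap (s x) ≡ just (s y) → Γ ⊢ₕ (x ↪ y)
    ↪-correct⇐ {x} x<N y<N with cell (s x) | cell-view (s x)
    ... | _ | represented x' _ sx≡sx' = λ e → ↪-congˡ (s-complete (sym sx≡sx')) (target-complete y<N (just-injective e))
    ... | _ | extra _ sx∈Ex           = ⊥-elim (value∉Extra x<N sx∈Ex)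
    ... | _ | free _ _                = λ ()

    domain : List LOC
    domain = S ++ Extra

    domain-complete : ∀ {l} → Allocated heap l → l ∈ domain
    domain-complete {l} with cell l | cell-view l
    ... | _ | represented x x∈R refl = λ _ → ∈-++⁺ˡ (∈-map⁺ s x∈R)
    ... | _ | extra _ l∈Ex           = λ _ → ∈-++⁺ʳ S l∈Ex
    ... | _ | free _ _               = λ allocated → ⊥-elim (allocated refl)

    domain-sound : ∀ {l} → l ∈ domain → Allocated heap l
    domain-sound {l} l∈dom with cell l | cell-view l
    ... | _ | represented _ _ _ = λ ()
    ... | _ | extra _ _         = λ ()
    ... | _ | free l∉S l∉Ex with ∈-++⁻ S l∈dom
    ...   | inj₁ l∈S  = ⊥-elim (l∉S l∈S)
    ...   | inj₂ l∈Ex = ⊥-elim (l∉Ex l∈Ex)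

    domain-length : length domain ≡ size
    domain-length = begin
      length (S ++ Extra)          ≡⟨ length-++ S ⟩
      length S + length Extra      ≡⟨ cong₂ _+_ (length-map s R) (length-applyUpTo (N +_) _) ⟩
      length R + fresh             ≡⟨ m+[n∸m]≡n (m≤n⊔m derivable-size (length R)) ⟩
      size                         ∎
      where open ≡-Reasoning

    domain-cells : Cells≥ heap size
    domain-cells = domain , domain-length , Uniqueₚ.++⁺ S-unique Extra-unique disjoint , All.tabulate domain-sound
      where
      disjoint : ∀ {l} → ¬ (l ∈ S × l ∈ Extra)
      disjoint (l∈S , l∈Ex) = <⇒≱ (S<N l∈S) (proj₁ (Extra-bounds l∈Ex))

    cells-bound : ∀ {β} → Cells≥ heap β → β ≤ size
    cells-bound (L , refl , uL , allocL) =
      subst (length L ≤_) domain-length (unique-⊆⇒length≤ L domain uL (λ l∈L → domain-complete (All.lookup allocL l∈L)))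

    size-correct⇒ : ∀ {β} → β ≤ N → Γ ⊢ₕ size≥ β → Cells≥ heap β
    size-correct⇒ {β} β≤N size-β =
      Cells≥-mono {heap} β size (≤-trans (derivable-size-max β β≤N size-β) (m≤m⊔n derivable-size (length R))) domain-cells

    size-correct⇐ : ∀ {β} → Cells≥ heap β → Γ ⊢ₕ size≥ β
    size-correct⇐ {β} cells with ⊔-sel derivable-size (length R)
    ... | inj₁ size≡derivable = size-mono β derivable-size (subst (β ≤_) size≡derivable (cells-bound cells)) derivable-size-holds
    ... | inj₂ size≡R         = size-mono β (length R) (subst (β ≤_) size≡R (cells-bound cells)) R-size

    core-correct : ∀ {a} (c : Core a) → Bounded N c → (s , heap ⊨ a → Γ ⊢ₕ a) × (Γ ⊢ₕ a → s , heap ⊨ a)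
    core-correct (core-eq x y)  _           = s-complete , s-sound
    core-correct (core-alloc x) x<N         = (λ sat → alloc-correct⇐ x<N (alloc-sem⇒ s heap x sat)) ,
                                              (λ alloc-x → alloc-sem⇐ s heap x (alloc-correct⇒ x<N alloc-x))
    core-correct (core-pt x y)  (x<N , y<N) = ↪-correct⇐ x<N y<N , ↪-correct⇒ x<N y<N
    core-correct (core-size β)  β≤N         = (λ sat → size-correct⇐ (size-sem⇒ β s heap sat)) ,
                                              (λ size-β → size-sem⇐ β s heap (size-correct⇒ β≤N size-β))

    Decided : ∀ {a} → Core a → Set
    Decided {a} _ = Γ ⊢ₕ a ⊎ Γ ⊢ₕ ¬' a

    Determined : Form → Set
    Determined ψ = (s , heap ⊨ ψ → Γ ⊢ₕ ψ) × (¬ (s , heap ⊨ ψ) → Γ ⊢ₕ ¬' ψ)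

    truth : ∀ {ψ} (bc : BoolComb ψ) → AllCore (Bounded N) bc → AllCore Decided bc → Determined ψ
    truth (bc-core c) bounded (inj₁ a)  =
      proj₁ (core-correct c bounded) , λ ¬sat → ⊥-elim (¬sat (proj₂ (core-correct c bounded) a))
    truth (bc-core c) bounded (inj₂ ¬a) = proj₁ (core-correct c bounded) , λ _ → ¬a
    truth (bc-not b) bounded decided =
      proj₂ (truth b bounded decided) , λ ¬¬sat → infer₁ Γ (⊢¬¬I _) (proj₁ (truth b bounded decided) (dne ¬¬sat))
    truth (bc-and {ψ₁} {ψ₂} b₁ b₂) (bounded₁ , bounded₂) (decided₁ , decided₂) =
      (λ (sat₁ , sat₂) → ∧-intro (proj₁ IH₁ sat₁) (proj₁ IH₂ sat₂)) , false-conjunct (em {s , heap ⊨ ψ₁})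
      where
      IH₁ : Determined ψ₁
      IH₁ = truth b₁ bounded₁ decided₁
      IH₂ : Determined ψ₂
      IH₂ = truth b₂ bounded₂ decided₂
      false-conjunct : Dec (s , heap ⊨ ψ₁) → ¬ (s , heap ⊨ (ψ₁ ∧' ψ₂)) → Γ ⊢ₕ ¬' (ψ₁ ∧' ψ₂)
      false-conjunct (no  ¬sat₁) _     = infer₁ Γ (⊢¬∧ˡ _ _) (proj₂ IH₁ ¬sat₁)
      false-conjunct (yes sat₁)  ¬sat = infer₁ Γ (⊢¬∧ʳ _ _) (proj₂ IH₂ λ sat₂ → ¬sat (sat₁ , sat₂))

  completeness : ∀ φ → BoolComb φ → Valid φ → ⊢ φ
  completeness φ bc valid = by-cases atoms φ branch
    where
    N : ℕ
    N = bound bc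
    equalities : List Form
    equalities = cartesianProductWith _≐_ (upTo N) (upTo N)
    atoms : List Form
    atoms = core-atoms bc ++ equalities
    branch : ∀ bs → length bs ≡ length atoms → literals atoms bs ⊢ₕ φ
    branch bs len = proj₁ (truth bc (bound-bounds bc) decided) (valid s heap)
      where
      Γ : List Form
      Γ = literals atoms bs
      decides : ∀ {a} → a ∈ atoms → Γ ⊢ₕ a ⊎ Γ ⊢ₕ ¬' a
      decides a∈atoms with literals-decide atoms bs len a∈atoms
      ... | inj₁ a∈Γ  = inj₁ (assumption Γ a∈Γ)
      ... | inj₂ ¬a∈Γ = inj₂ (assumption Γ ¬a∈Γ)
      ≐-decided : ∀ x y → x < N → y < N → Γ ⊢ₕ (x ≐ y) ⊎ Γ ⊢ₕ ¬' (x ≐ y)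
      ≐-decided x y x<N y<N =
        decides (∈-++⁺ʳ (core-atoms bc) (∈-cartesianProductWith⁺ _≐_ (∈-upTo⁺ x<N) (∈-upTo⁺ y<N)))
      open CanonicalModel Γ N ≐-decided
      decided : AllCore Decided bc
      decided = AllCore-map (λ _ a∈atoms → decides (∈-++⁺ˡ a∈atoms)) bc (core-atoms-complete bc)

theorem4p3 : ExcludedMiddle 0ℓ → ∀ (φ : Form) → BoolComb φ → Valid φ ⇔ (⊢ φ)
theorem4p3 em φ bc = mk⇔ (completeness φ bc) soundness
  where open Classical em
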